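{- Let $G$ be a finite abelian group, $S\subseteq G$ with $0\in S$ a $2$-separable subset, and $A$ a $2$-atom of $S$ with $0\in A$, $|A|\ge 3$, which is not a subgroup of $G$. Writing $A^*=A\setminus\{0\}$, we have $S+A=S+(A\setminus\{a\})$ for each $a\in A$, and $N_2(S,A)-A^*\subseteq N_1(S,A)$.
   Context: For $S\subseteq G$ with $0\in S$, $\langle S\rangle$ is the subgroup generated by $S$. $S$ is $2$-separable if there exists $X\subseteq\langle S\rangle$ with $|X|\ge 2$ and $|X+S|\le|\langle S\rangle|-2$; then $\kappa_2(S)=\min\{|X+S|-|X| : X\subseteq\langle S\rangle,\ |X|\ge 2,\ |X+S|\le|\langle S\rangle|-2\}$; a set attaining it is a $2$-fragment and one of minimum cardinality is a $2$-atom. For $X,Y\subseteq G$, $iY=Y+\dots+Y$ ($i$ times), $N_0(X,Y)=X$, and $N_i(X,Y)=(X+iY)\setminus(X+(i-1)Y)$ for $i\ge1$. -}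

module Defs where

open import Data.Nat using (ℕ; zero; suc; _≤_; _∸_)
open import Data.Fin using (Fin)
open import Data.Fin.Properties using (any?)
open import Data.Fin.Subset using (Subset; _∈_; _⊆_; ∣_∣; ⁅_⁆; _─_)
open import Data.Fin.Subset.Properties using (_∈?_)
open import Data.Vec using (tabulate)
open import Data.Product using (_×_; Σ; ∃; _,_)
open import Data.Bool using (if_then_else_)
open import Relation.Nullary using (¬_; does)
open import Relation.Nullary.Decidable using (_×-dec_)
open import Relation.Binary.PropositionalEquality using (_≡_)
open import Data.Fin.Properties using (_≟_)
open import Data.Fin.Subset using (inside; outside)
open import Algebra.Structures using (IsAbelianGroup)

-- A finite abelian group, presented (up to isomorphism) on the carrier Fin n,
-- with propositional equality.
record FinAbGroup : Set where
  field
    n   : ℕ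
    _+_ : Fin n → Fin n → Fin n
    0#  : Fin n
    -_  : Fin n → Fin n
    isAbelianGroup : IsAbelianGroup _≡_ _+_ 0# -_

module Ops (G : FinAbGroup) where
  open FinAbGroup G public

  image₂ : (Fin n → Fin n → Fin n) → Subset n → Subset n → Subset n
  image₂ _∘_ X Y = tabulate λ z →
    if does (any? λ x → any? λ y → (x ∈? X) ×-dec ((y ∈? Y) ×-dec ((x ∘ y) ≟ z)))
    then inside else outside

  _⊕_ : Subset n → Subset n → Subset n
  _⊕_ = image₂ _+_

  _⊖_ : Subset n → Subset n → Subset n
  _⊖_ = image₂ (λ x y → x + (- y))

  _·_ : ℕ → Subset n → Subset n
  zero  · Y = ⁅ 0# ⁆
  suc i · Y = (i · Y) ⊕ Y

  N : ℕ → Subset n → Subset n → Subset n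
  N zero    X Y = X
  N (suc i) X Y = (X ⊕ (suc i · Y)) ─ (X ⊕ (i · Y))

  IsSubgroup : Subset n → Set
  IsSubgroup K = (0# ∈ K)
               × (∀ x y → x ∈ K → y ∈ K → (x + y) ∈ K)
               × (∀ x → x ∈ K → (- x) ∈ K)

  IsGeneratedBy : Subset n → Subset n → Set
  IsGeneratedBy H S = IsSubgroup H × S ⊆ H
                    × (∀ K → IsSubgroup K → S ⊆ K → H ⊆ K)

  -- X is admissible for κ₂(S), where H = ⟨S⟩:
  -- X ⊆ ⟨S⟩, |X| ≥ 2, |X + S| ≤ |⟨S⟩| - 2
  Admissible₂ : Subset n → Subset n → Subset n → Set
  Admissible₂ S H X = X ⊆ H × 2 ≤ ∣ X ∣ × ∣ X ⊕ S ∣ ≤ ∣ H ∣ ∸ 2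

  TwoSeparable : Subset n → Subset n → Set
  TwoSeparable S H = ∃ λ X → Admissible₂ S H X

  -- X attains κ₂(S) = min |X + S| - |X| over admissible X
  -- (|X+S| - |X| ≥ 0 since 0 ∈ S, so truncated subtraction is exact)
  TwoFragment : Subset n → Subset n → Subset n → Set
  TwoFragment S H X = Admissible₂ S H X
    × (∀ Y → Admissible₂ S H Y → ∣ X ⊕ S ∣ ∸ ∣ X ∣ ≤ ∣ Y ⊕ S ∣ ∸ ∣ Y ∣)

  TwoAtom : Subset n → Subset n → Subset n → Set
  TwoAtom S H A = TwoFragment S H A
    × (∀ Y → TwoFragment S H Y → ∣ A ∣ ≤ ∣ Y ∣)

-- Deleting a point a from the 2-atom A cannot shrink A + S: otherwise A ∖ {a} would be admissible,
-- of no larger excess |X + S| − |X|, and smaller than A.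
-- For the second claim let x ∈ H ∖ (A + S) with x − a ∈ A + S for some a ∈ A, and suppose x − b ∉ A + S
-- for some b ∈ A∗. Put Q = x − (H ∖ (A + S)). Then Q + S avoids x − A, so the excess of Q is at most that
-- of A, and 0, b ∈ A ∩ Q makes both A ∩ Q and A ∪ Q admissible. Submodularity of X ↦ |X + S| bounds the
-- excess of A ∩ Q by that of A, so A ∩ Q is a 2-fragment; but a ∉ Q, so it is smaller than the atom A.
-- An element w = s + a₁ + a₂ of N₂(S, A) is such an x (with a = a₂), and w − b ∉ S because w ∉ S + A.

module Submission where

open import Defs
open import Algebra.Structures using (IsAbelianGroup; IsGroup)
open import Algebra.Bundles using (AbelianGroup)
open import Data.Bool.Base using (Bool; if_then_else_)
open import Data.Fin.Base using (Fin)
open import Data.Fin.Permutation using (Permutation′; permutation; _⟨$⟩ʳ_)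
open import Data.Fin.Properties using (any?; _≟_)
open import Data.Fin.Subset
  using (Subset; inside; outside; _∈_; _∉_; _⊆_; _∩_; _∪_; _─_; _-_; ∣_∣; ⁅_⁆)
open import Data.Fin.Subset.Properties
  using ( _∈?_; ⊆-antisym; x∈⁅x⁆; x∈⁅y⁆⇒x≡y; x∉⁅y⁆⇒x≢y; ∣⁅x⁆∣≡1; x∈p∩q⁺; x∈p∪q⁺; x∈p∪q⁻
        ; p∩q⊆p; p∩q⊆q; p─q⊆p; x∈p∧x∉q⇒x∈p─q; x∈p∧x≢y⇒x∈p-y
        ; p⊆q⇒∣p∣≤∣q∣; p⊂q⇒∣p∣<∣q∣; ∣p∩q∣≤∣q∣; ∣p∣≤∣p∪q∣; x∈p⇒∣p-x∣<∣p∣)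
open import Data.Nat.Base using (ℕ; suc; _+_; _∸_; _≤_; _<_; s≤s; s≤s⁻¹)
open import Data.Nat.Properties
  using ( +-0-commutativeMonoid; +-assoc; +-comm; +-suc; +-cancelʳ-≤; +-mono-≤; +-monoˡ-≤; +-monoʳ-≤
        ; ≤-trans; ≤-reflexive; <-≤-trans; ≤-<-trans; <⇒≤; <⇒≱; m∸n+n≡m; m+n≤o⇒m≤o∸n; module ≤-Reasoning)
open import Data.Nat.Tactic.RingSolver using (solve-∀)
open import Data.Product using (_×_; _,_; ∃₂; proj₁)
open import Data.Sum using (inj₁; inj₂)
open import Data.Vec.Base using ([]; _∷_; lookup; tabulate; here; there)
open import Data.Vec.Properties using (lookup∘tabulate; []=⇒lookup; lookup⇒[]=)
open import Level using (0ℓ)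
open import Relation.Nullary using (¬_; Dec; yes; no; does; contradiction)
open import Relation.Nullary.Decidable using (_×-dec_)
open import Relation.Binary.PropositionalEquality
  using (_≡_; _≢_; refl; sym; trans; cong; cong₂; subst; module ≡-Reasoning)
open import Algebra.Properties.CommutativeMonoid.Sum +-0-commutativeMonoid
  using (sum; sum-permute; sum-cong-≗)

m+p≤o+n⇒m∸n≤o∸p : ∀ {m n o p} → n ≤ m → m + p ≤ o + n → m ∸ n ≤ o ∸ p
m+p≤o+n⇒m∸n≤o∸p {m} {n} {o} {p} n≤m le = m+n≤o⇒m≤o∸n (m ∸ n) (+-cancelʳ-≤ n _ _ (begin
  m ∸ n + p + n  ≡⟨ +-assoc (m ∸ n) p n ⟩
  m ∸ n + (p + n) ≡⟨ cong (m ∸ n +_) (+-comm p n) ⟩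
  m ∸ n + (n + p) ≡⟨ +-assoc (m ∸ n) n p ⟨
  m ∸ n + n + p  ≡⟨ cong (_+ p) (m∸n+n≡m n≤m) ⟩
  m + p          ≤⟨ le ⟩
  o + n          ∎))
  where open ≤-Reasoning

m∸n≤o∸p⇒m+p≤o+n : ∀ {m n o p} → n ≤ m → p ≤ o → m ∸ n ≤ o ∸ p → m + p ≤ o + n
m∸n≤o∸p⇒m+p≤o+n {m} {n} {o} {p} n≤m p≤o le = begin
  m + p           ≡⟨ cong (_+ p) (m∸n+n≡m n≤m) ⟨
  m ∸ n + n + p   ≤⟨ +-monoˡ-≤ p (+-monoˡ-≤ n le) ⟩
  o ∸ p + n + p   ≡⟨ +-assoc (o ∸ p) n p ⟩
  o ∸ p + (n + p) ≡⟨ cong (o ∸ p +_) (+-comm n p) ⟩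
  o ∸ p + (p + n) ≡⟨ +-assoc (o ∸ p) p n ⟨
  o ∸ p + p + n   ≡⟨ cong (_+ n) (m∸n+n≡m p≤o) ⟩
  o + n           ∎
  where open ≤-Reasoning

-- Reading z′ ∸ z as an excess κ, this says: κX + κY ≤ κA + κQ and κQ ≤ κA ≤ κY give κX ≤ κA.
excess-submodular : ∀ {x x′ y y′ a a′ q q′} →
  x′ + y′ ≤ a′ + q′ → x + y ≡ a + q → q′ + a ≤ a′ + q → a′ + y ≤ y′ + a →
  x′ + a ≤ a′ + x
excess-submodular {x} {x′} {y} {y′} {a} {a′} {q} {q′} sub card dual frag =
  +-cancelʳ-≤ (a′ + y) (x′ + a) (a′ + x) (begin
    x′ + a + (a′ + y)         ≤⟨ +-monoʳ-≤ (x′ + a) frag ⟩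
    x′ + a + (y′ + a)         ≡⟨ shuffle₁ x′ a y′ ⟩
    x′ + y′ + (a + a)         ≤⟨ +-monoˡ-≤ (a + a) sub ⟩
    a′ + q′ + (a + a)         ≡⟨ shuffle₂ a′ q′ a ⟩
    a′ + a + (q′ + a)         ≤⟨ +-monoʳ-≤ (a′ + a) dual ⟩
    a′ + a + (a′ + q)         ≡⟨ shuffle₃ a′ a q ⟩
    a′ + a′ + (a + q)         ≡⟨ cong (a′ + a′ +_) card ⟨
    a′ + a′ + (x + y)         ≡⟨ shuffle₄ a′ x y ⟩
    a′ + x + (a′ + y)         ∎)
  where
  open ≤-Reasoning
  shuffle₁ : ∀ x′ a y′ → x′ + a + (y′ + a) ≡ x′ + y′ + (a + a)
  shuffle₁ = solve-∀
  shuffle₂ : ∀ a′ q′ a → a′ + q′ + (a + a) ≡ a′ + a + (q′ + a)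
  shuffle₂ = solve-∀
  shuffle₃ : ∀ a′ a q → a′ + a + (a′ + q) ≡ a′ + a′ + (a + q)
  shuffle₃ = solve-∀
  shuffle₄ : ∀ a′ x y → a′ + a′ + (x + y) ≡ a′ + x + (a′ + y)
  shuffle₄ = solve-∀

private
  variable
    m : ℕ

x∈p─q⇒x∉q : ∀ {p q : Subset m} {x} → x ∈ p ─ q → x ∉ q
x∈p─q⇒x∉q {p = _ ∷ p} {q = outside ∷ q} here ()
x∈p─q⇒x∉q {p = _ ∷ p} {q = _ ∷ q} (there x∈p─q) (there x∈q) = x∈p─q⇒x∉q x∈p─q x∈q

∣p─q∣+∣p∩q∣≡∣p∣ : ∀ (p q : Subset m) → ∣ p ─ q ∣ + ∣ p ∩ q ∣ ≡ ∣ p ∣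
∣p─q∣+∣p∩q∣≡∣p∣ [] [] = refl
∣p─q∣+∣p∩q∣≡∣p∣ (inside ∷ p) (inside ∷ q) = trans (+-suc _ _) (cong suc (∣p─q∣+∣p∩q∣≡∣p∣ p q))
∣p─q∣+∣p∩q∣≡∣p∣ (inside ∷ p) (outside ∷ q) = cong suc (∣p─q∣+∣p∩q∣≡∣p∣ p q)
∣p─q∣+∣p∩q∣≡∣p∣ (outside ∷ p) (inside ∷ q) = ∣p─q∣+∣p∩q∣≡∣p∣ p q
∣p─q∣+∣p∩q∣≡∣p∣ (outside ∷ p) (outside ∷ q) = ∣p─q∣+∣p∩q∣≡∣p∣ p q

∣p∩q∣+∣p∪q∣≡∣p∣+∣q∣ : ∀ (p q : Subset m) → ∣ p ∩ q ∣ + ∣ p ∪ q ∣ ≡ ∣ p ∣ + ∣ q ∣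
∣p∩q∣+∣p∪q∣≡∣p∣+∣q∣ [] [] = refl
∣p∩q∣+∣p∪q∣≡∣p∣+∣q∣ (inside ∷ p) (inside ∷ q) =
  cong suc (trans (+-suc _ _) (trans (cong suc (∣p∩q∣+∣p∪q∣≡∣p∣+∣q∣ p q)) (sym (+-suc _ _))))
∣p∩q∣+∣p∪q∣≡∣p∣+∣q∣ (inside ∷ p) (outside ∷ q) =
  trans (+-suc _ _) (cong suc (∣p∩q∣+∣p∪q∣≡∣p∣+∣q∣ p q))
∣p∩q∣+∣p∪q∣≡∣p∣+∣q∣ (outside ∷ p) (inside ∷ q) =
  trans (+-suc _ _) (trans (cong suc (∣p∩q∣+∣p∪q∣≡∣p∣+∣q∣ p q)) (sym (+-suc _ _)))
∣p∩q∣+∣p∪q∣≡∣p∣+∣q∣ (outside ∷ p) (outside ∷ q) = ∣p∩q∣+∣p∪q∣≡∣p∣+∣q∣ p q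

∣p∣≤∣p─q∣+∣q∣ : ∀ (p q : Subset m) → ∣ p ∣ ≤ ∣ p ─ q ∣ + ∣ q ∣
∣p∣≤∣p─q∣+∣q∣ p q = begin
  ∣ p ∣               ≡⟨ ∣p─q∣+∣p∩q∣≡∣p∣ p q ⟨
  ∣ p ─ q ∣ + ∣ p ∩ q ∣ ≤⟨ +-monoʳ-≤ ∣ p ─ q ∣ (∣p∩q∣≤∣q∣ p q) ⟩
  ∣ p ─ q ∣ + ∣ q ∣     ∎
  where open ≤-Reasoning

q⊆p⇒∣p─q∣+∣q∣≡∣p∣ : ∀ {p q : Subset m} → q ⊆ p → ∣ p ─ q ∣ + ∣ q ∣ ≡ ∣ p ∣
q⊆p⇒∣p─q∣+∣q∣≡∣p∣ {p = p} {q} q⊆p = trans (cong (λ r → ∣ p ─ q ∣ + ∣ r ∣) (sym p∩q≡q)) (∣p─q∣+∣p∩q∣≡∣p∣ p q)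
  where
  p∩q≡q : p ∩ q ≡ q
  p∩q≡q = ⊆-antisym (p∩q⊆q p q) (λ x∈q → x∈p∩q⁺ (q⊆p x∈q , x∈q))

x∈p∧y∈p∧x≢y⇒2≤∣p∣ : ∀ {p : Subset m} {x y} → x ∈ p → y ∈ p → x ≢ y → 2 ≤ ∣ p ∣
x∈p∧y∈p∧x≢y⇒2≤∣p∣ {p = p} {x} {y} x∈p y∈p x≢y = <-≤-trans (s≤s 1≤∣p-y∣) (x∈p⇒∣p-x∣<∣p∣ y∈p)
  where
  1≤∣p-y∣ : 1 ≤ ∣ p - y ∣
  1≤∣p-y∣ = ≤-trans (≤-reflexive (sym (∣⁅x⁆∣≡1 x)))
    (p⊆q⇒∣p∣≤∣q∣ λ z∈⁅x⁆ → subst (_∈ p - y) (sym (x∈⁅y⁆⇒x≡y x z∈⁅x⁆)) (x∈p∧x≢y⇒x∈p-y x∈p x≢y))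

∈-tabulate⁻ : ∀ (f : Fin m → Bool) {x} → x ∈ tabulate f → f x ≡ inside
∈-tabulate⁻ f {x} x∈ = trans (sym (lookup∘tabulate f x)) ([]=⇒lookup x∈)

∈-tabulate⁺ : ∀ (f : Fin m → Bool) {x} → f x ≡ inside → x ∈ tabulate f
∈-tabulate⁺ f {x} fx≡inside = lookup⇒[]= x _ (trans (lookup∘tabulate f x) fx≡inside)

∣p∣≡sum : ∀ (p : Subset m) → ∣ p ∣ ≡ sum (λ i → if lookup p i then 1 else 0)
∣p∣≡sum [] = refl
∣p∣≡sum (inside ∷ p) = cong suc (∣p∣≡sum p)
∣p∣≡sum (outside ∷ p) = ∣p∣≡sum p

opaque
  preimage : (Fin m → Fin m) → Subset m → Subset m
  preimage f p = tabulate (λ x → lookup p (f x))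

  ∈-preimage⁻ : ∀ {f : Fin m → Fin m} {p x} → x ∈ preimage f p → f x ∈ p
  ∈-preimage⁻ {f = f} {p} x∈ = lookup⇒[]= (f _) p (∈-tabulate⁻ (λ y → lookup p (f y)) x∈)

  ∈-preimage⁺ : ∀ {f : Fin m → Fin m} {p x} → f x ∈ p → x ∈ preimage f p
  ∈-preimage⁺ {f = f} {p} fx∈p = ∈-tabulate⁺ (λ y → lookup p (f y)) ([]=⇒lookup fx∈p)

  ∣preimage∣≡∣p∣ : ∀ (π : Permutation′ m) p → ∣ preimage (π ⟨$⟩ʳ_) p ∣ ≡ ∣ p ∣
  ∣preimage∣≡∣p∣ π p = begin
    ∣ preimage (π ⟨$⟩ʳ_) p ∣                                       ≡⟨ ∣p∣≡sum (preimage (π ⟨$⟩ʳ_) p) ⟩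
    sum (λ i → if lookup (preimage (π ⟨$⟩ʳ_) p) i then 1 else 0) ≡⟨ sum-cong-≗ lookup-preimage ⟩
    sum (λ i → if lookup p (π ⟨$⟩ʳ i) then 1 else 0)             ≡⟨ sum-permute _ π ⟨
    sum (λ i → if lookup p i then 1 else 0)                     ≡⟨ ∣p∣≡sum p ⟨
    ∣ p ∣                                                       ∎
    where
    open ≡-Reasoning
    lookup-preimage : ∀ i → (if lookup (preimage (π ⟨$⟩ʳ_) p) i then 1 else 0)
                          ≡ (if lookup p (π ⟨$⟩ʳ i) then 1 else 0)
    lookup-preimage i = cong (if_then 1 else 0) (lookup∘tabulate (λ y → lookup p (π ⟨$⟩ʳ y)) i)

does-inside⁻ : ∀ {P : Set} (P? : Dec P) → (if does P? then inside else outside) ≡ inside → P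
does-inside⁻ (yes p) _ = p

does-inside⁺ : ∀ {P : Set} (P? : Dec P) → P → (if does P? then inside else outside) ≡ inside
does-inside⁺ (yes _) _ = refl
does-inside⁺ (no ¬p) p = contradiction p ¬p

module Sumsets (G : FinAbGroup) where

  open Ops G renaming (_+_ to _∙_)
  open IsAbelianGroup isAbelianGroup using (assoc; comm; identityˡ; identityʳ; isGroup)
  open IsGroup isGroup using (_//_)

  private
    abelianGroup : AbelianGroup 0ℓ 0ℓ
    abelianGroup = record { isAbelianGroup = isAbelianGroup }

  open import Algebra.Properties.AbelianGroup abelianGroup
    using (//-rightDividesˡ; //-rightDividesʳ; ε⁻¹≈ε; ⁻¹-anti-homo‿-; xyx⁻¹≈y)

  private
    image₂? : ∀ (_∘_ : Fin n → Fin n → Fin n) X Y z → Dec (∃₂ λ x y → x ∈ X × y ∈ Y × x ∘ y ≡ z)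
    image₂? _∘_ X Y z = any? λ x → any? λ y → (x ∈? X) ×-dec ((y ∈? Y) ×-dec ((x ∘ y) ≟ z))

  x//0≡x : ∀ x → x // 0# ≡ x
  x//0≡x x = trans (cong (x ∙_) ε⁻¹≈ε) (identityʳ x)

  x//[x//y]≡y : ∀ x y → x // (x // y) ≡ y
  x//[x//y]≡y x y = begin
    x ∙ (- (x // y)) ≡⟨ cong (x ∙_) (⁻¹-anti-homo‿- x y) ⟩
    x ∙ (y // x)     ≡⟨ assoc x y (- x) ⟨
    (x ∙ y) // x     ≡⟨ xyx⁻¹≈y x y ⟩
    y                ∎
    where open ≡-Reasoning

  [x//[y∙z]]∙z≡x//y : ∀ x y z → (x // (y ∙ z)) ∙ z ≡ x // y
  [x//[y∙z]]∙z≡x//y x y z = begin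
    (w ∙ z)             ≡⟨ //-rightDividesʳ y (w ∙ z) ⟨
    ((w ∙ z) ∙ y) // y  ≡⟨ cong (_// y) (assoc w z y) ⟩
    (w ∙ (z ∙ y)) // y  ≡⟨ cong (λ v → (w ∙ v) // y) (comm z y) ⟩
    (w ∙ (y ∙ z)) // y  ≡⟨ cong (_// y) (//-rightDividesˡ (y ∙ z) x) ⟩
    x // y              ∎
    where
    open ≡-Reasoning
    w : Fin n
    w = x // (y ∙ z)

  [x//y]∙y≡x : ∀ x y → (x // y) ∙ y ≡ x
  [x//y]∙y≡x x y = //-rightDividesˡ y x

  [x∙[y∙z]]//z≡x∙y : ∀ x y z → (x ∙ (y ∙ z)) // z ≡ x ∙ y
  [x∙[y∙z]]//z≡x∙y x y z = trans (cong (_// z) (sym (assoc x y z))) (//-rightDividesʳ z (x ∙ y))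

  ∈-image₂⁻ : ∀ (_∘_ : Fin n → Fin n → Fin n) X Y {z} → z ∈ image₂ _∘_ X Y →
              ∃₂ λ x y → x ∈ X × y ∈ Y × x ∘ y ≡ z
  ∈-image₂⁻ _∘_ X Y {z} z∈ =
    does-inside⁻ (image₂? _∘_ X Y z)
      (∈-tabulate⁻ (λ z → if does (image₂? _∘_ X Y z) then inside else outside) z∈)

  ∈-image₂⁺ : ∀ (_∘_ : Fin n → Fin n → Fin n) {X Y x y} → x ∈ X → y ∈ Y → x ∘ y ∈ image₂ _∘_ X Y
  ∈-image₂⁺ _∘_ {X} {Y} {x} {y} x∈X y∈Y =
    ∈-tabulate⁺ (λ z → if does (image₂? _∘_ X Y z) then inside else outside)
      (does-inside⁺ (image₂? _∘_ X Y (x ∘ y)) (x , y , x∈X , y∈Y , refl))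

  ∈-⊕⁻ : ∀ {X Y z} → z ∈ X ⊕ Y → ∃₂ λ x y → x ∈ X × y ∈ Y × x ∙ y ≡ z
  ∈-⊕⁻ = ∈-image₂⁻ _∙_ _ _

  ∈-⊕⁺ : ∀ {X Y x y} → x ∈ X → y ∈ Y → x ∙ y ∈ X ⊕ Y
  ∈-⊕⁺ = ∈-image₂⁺ _∙_

  ⊕-comm : ∀ X Y → X ⊕ Y ≡ Y ⊕ X
  ⊕-comm X Y = ⊆-antisym (⊕-swap X Y) (⊕-swap Y X)
    where
    ⊕-swap : ∀ X Y → X ⊕ Y ⊆ Y ⊕ X
    ⊕-swap X Y z∈ with ∈-⊕⁻ z∈
    ... | x , y , x∈X , y∈Y , refl = subst (_∈ Y ⊕ X) (comm y x) (∈-⊕⁺ y∈Y x∈X)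

  ⊕-monoˡ : ∀ {X X′} Y → X ⊆ X′ → X ⊕ Y ⊆ X′ ⊕ Y
  ⊕-monoˡ Y X⊆X′ z∈ with ∈-⊕⁻ z∈
  ... | x , y , x∈X , y∈Y , refl = ∈-⊕⁺ (X⊆X′ x∈X) y∈Y

  ⁅0⁆⊕X≡X : ∀ X → ⁅ 0# ⁆ ⊕ X ≡ X
  ⁅0⁆⊕X≡X X = ⊆-antisym ⊆X X⊆
    where
    ⊆X : ⁅ 0# ⁆ ⊕ X ⊆ X
    ⊆X z∈ with ∈-⊕⁻ z∈
    ... | o , x , o∈⁅0⁆ , x∈X , refl rewrite x∈⁅y⁆⇒x≡y 0# o∈⁅0⁆ = subst (_∈ X) (sym (identityˡ x)) x∈X
    X⊆ : X ⊆ ⁅ 0# ⁆ ⊕ X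
    X⊆ {x} x∈X = subst (_∈ ⁅ 0# ⁆ ⊕ X) (identityˡ x) (∈-⊕⁺ (x∈⁅x⁆ 0#) x∈X)

  X⊆X⊕S : ∀ {S} X → 0# ∈ S → X ⊆ X ⊕ S
  X⊆X⊕S X 0∈S {x} x∈X = subst (_∈ X ⊕ _) (identityʳ x) (∈-⊕⁺ x∈X 0∈S)

  ∣X∣≤∣X⊕S∣ : ∀ {S} X → 0# ∈ S → ∣ X ∣ ≤ ∣ X ⊕ S ∣
  ∣X∣≤∣X⊕S∣ X 0∈S = p⊆q⇒∣p∣≤∣q∣ (X⊆X⊕S X 0∈S)

  ⊕-submodular : ∀ X Y S → ∣ (X ∩ Y) ⊕ S ∣ + ∣ (X ∪ Y) ⊕ S ∣ ≤ ∣ X ⊕ S ∣ + ∣ Y ⊕ S ∣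
  ⊕-submodular X Y S = begin
    ∣ (X ∩ Y) ⊕ S ∣ + ∣ (X ∪ Y) ⊕ S ∣       ≤⟨ +-mono-≤ (p⊆q⇒∣p∣≤∣q∣ ∩-⊕) (p⊆q⇒∣p∣≤∣q∣ ∪-⊕) ⟩
    ∣ (X ⊕ S) ∩ (Y ⊕ S) ∣ + ∣ (X ⊕ S) ∪ (Y ⊕ S) ∣ ≡⟨ ∣p∩q∣+∣p∪q∣≡∣p∣+∣q∣ (X ⊕ S) (Y ⊕ S) ⟩
    ∣ X ⊕ S ∣ + ∣ Y ⊕ S ∣                   ∎
    where
    open ≤-Reasoning
    ∩-⊕ : (X ∩ Y) ⊕ S ⊆ (X ⊕ S) ∩ (Y ⊕ S)
    ∩-⊕ z∈ = x∈p∩q⁺ (⊕-monoˡ S (p∩q⊆p X Y) z∈ , ⊕-monoˡ S (p∩q⊆q X Y) z∈)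
    ∪-⊕ : (X ∪ Y) ⊕ S ⊆ (X ⊕ S) ∪ (Y ⊕ S)
    ∪-⊕ z∈ with ∈-⊕⁻ z∈
    ... | u , s , u∈X∪Y , s∈S , refl with x∈p∪q⁻ X Y u∈X∪Y
    ...   | inj₁ u∈X = x∈p∪q⁺ (inj₁ (∈-⊕⁺ u∈X s∈S))
    ...   | inj₂ u∈Y = x∈p∪q⁺ (inj₂ (∈-⊕⁺ u∈Y s∈S))

  N₁≡ : ∀ X Y → N 1 X Y ≡ (X ⊕ Y) ─ X
  N₁≡ X Y = cong₂ (λ U V → (X ⊕ U) ─ V) (⁅0⁆⊕X≡X Y) (trans (⊕-comm X ⁅ 0# ⁆) (⁅0⁆⊕X≡X X))

  N₂≡ : ∀ X Y → N 2 X Y ≡ (X ⊕ (Y ⊕ Y)) ─ (X ⊕ Y)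
  N₂≡ X Y = cong (λ U → (X ⊕ (U ⊕ Y)) ─ (X ⊕ U)) (⁅0⁆⊕X≡X Y)

  module Subgroup {H : Subset n} (H≤G : IsSubgroup H) where

    ∙-closed : ∀ {x y} → x ∈ H → y ∈ H → x ∙ y ∈ H
    ∙-closed = let (_ , closed , _) = H≤G in closed _ _

    //-closed : ∀ {x y} → x ∈ H → y ∈ H → x // y ∈ H
    //-closed x∈H y∈H = let (_ , _ , inv-closed) = H≤G in ∙-closed x∈H (inv-closed _ y∈H)

    ⊕-closed : ∀ {X Y} → X ⊆ H → Y ⊆ H → X ⊕ Y ⊆ H
    ⊕-closed X⊆H Y⊆H z∈ with ∈-⊕⁻ z∈
    ... | x , y , x∈X , y∈Y , refl = ∙-closed (X⊆H x∈X) (Y⊆H y∈Y)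

module TwoAtoms (G : FinAbGroup) where

  open Ops G renaming (_+_ to _∙_)
  open Sumsets G
  open IsAbelianGroup isAbelianGroup using (isGroup)
  open IsGroup isGroup using (_//_)

  module _ {S H : Subset n} (0∈S : 0# ∈ S) where

    -- Excesses are compared additively, |X + S| + |A| ≤ |A + S| + |X|, to avoid truncated subtraction.
    fragment-optimal : ∀ {F Y} → TwoFragment S H F → Admissible₂ S H Y →
                       ∣ F ⊕ S ∣ + ∣ Y ∣ ≤ ∣ Y ⊕ S ∣ + ∣ F ∣
    fragment-optimal {F} {Y} (_ , optimal) admY =
      m∸n≤o∸p⇒m+p≤o+n (∣X∣≤∣X⊕S∣ F 0∈S) (∣X∣≤∣X⊕S∣ Y 0∈S) (optimal Y admY)

    atom-minimal : ∀ {A X} → TwoAtom S H A → Admissible₂ S H X →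
                   ∣ X ⊕ S ∣ + ∣ A ∣ ≤ ∣ A ⊕ S ∣ + ∣ X ∣ → ∣ A ∣ ≤ ∣ X ∣
    atom-minimal {A} {X} ((_ , optimal) , minimal) admX excess≤ = minimal X (admX , λ Y admY →
      ≤-trans (m+p≤o+n⇒m∸n≤o∸p (∣X∣≤∣X⊕S∣ X 0∈S) excess≤) (optimal Y admY))

    module Atom {A : Subset n} (atom : TwoAtom S H A) where

      private
        admA : Admissible₂ S H A
        admA = proj₁ (proj₁ atom)
        A⊆H : A ⊆ H
        A⊆H = let (A⊆H , _ , _) = admA in A⊆H
        2≤∣A∣ : 2 ≤ ∣ A ∣
        2≤∣A∣ = let (_ , 2≤∣A∣ , _) = admA in 2≤∣A∣
        ∣A⊕S∣≤∣H∣∸2 : ∣ A ⊕ S ∣ ≤ ∣ H ∣ ∸ 2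
        ∣A⊕S∣≤∣H∣∸2 = let (_ , _ , bound) = admA in bound

      A-a⊕S≡A⊕S : 3 ≤ ∣ A ∣ → ∀ {a} → a ∈ A → (A - a) ⊕ S ≡ A ⊕ S
      A-a⊕S≡A⊕S 3≤∣A∣ {a} a∈A = ⊆-antisym (⊕-monoˡ S A-a⊆A) A⊕S⊆
        where
        A-a⊆A : A - a ⊆ A
        A-a⊆A = p─q⊆p A ⁅ a ⁆
        ∣A∣≤1+∣A-a∣ : ∣ A ∣ ≤ suc ∣ A - a ∣
        ∣A∣≤1+∣A-a∣ = ≤-trans (∣p∣≤∣p─q∣+∣q∣ A ⁅ a ⁆)
          (≤-reflexive (trans (cong (∣ A - a ∣ +_) (∣⁅x⁆∣≡1 a)) (+-comm ∣ A - a ∣ 1)))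
        A⊕S⊆ : A ⊕ S ⊆ (A - a) ⊕ S
        A⊕S⊆ {z} z∈ with z ∈? (A - a) ⊕ S
        ... | yes z∈′ = z∈′
        ... | no z∉ = contradiction (atom-minimal atom adm excess≤) (<⇒≱ (x∈p⇒∣p-x∣<∣p∣ a∈A))
          where
          ∣A-a⊕S∣<∣A⊕S∣ : ∣ (A - a) ⊕ S ∣ < ∣ A ⊕ S ∣
          ∣A-a⊕S∣<∣A⊕S∣ = p⊂q⇒∣p∣<∣q∣ (⊕-monoˡ S A-a⊆A , z , z∈ , z∉)
          adm : Admissible₂ S H (A - a)
          adm = (λ x∈ → A⊆H (A-a⊆A x∈)) , s≤s⁻¹ (≤-trans 3≤∣A∣ ∣A∣≤1+∣A-a∣) ,
                ≤-trans (<⇒≤ ∣A-a⊕S∣<∣A⊕S∣) ∣A⊕S∣≤∣H∣∸2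
          excess≤ : ∣ (A - a) ⊕ S ∣ + ∣ A ∣ ≤ ∣ A ⊕ S ∣ + ∣ A - a ∣
          excess≤ = begin
            ∣ (A - a) ⊕ S ∣ + ∣ A ∣         ≤⟨ +-monoʳ-≤ ∣ (A - a) ⊕ S ∣ ∣A∣≤1+∣A-a∣ ⟩
            ∣ (A - a) ⊕ S ∣ + suc ∣ A - a ∣ ≡⟨ +-suc ∣ (A - a) ⊕ S ∣ ∣ A - a ∣ ⟩
            suc ∣ (A - a) ⊕ S ∣ + ∣ A - a ∣ ≤⟨ +-monoˡ-≤ ∣ A - a ∣ ∣A-a⊕S∣<∣A⊕S∣ ⟩
            ∣ A ⊕ S ∣ + ∣ A - a ∣           ∎
            where open ≤-Reasoning

      S⊕A≡S⊕[A-a] : 3 ≤ ∣ A ∣ → ∀ {a} → a ∈ A → S ⊕ A ≡ S ⊕ (A - a)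
      S⊕A≡S⊕[A-a] 3≤∣A∣ {a} a∈A = begin
        S ⊕ A       ≡⟨ ⊕-comm S A ⟩
        A ⊕ S       ≡⟨ A-a⊕S≡A⊕S 3≤∣A∣ a∈A ⟨
        (A - a) ⊕ S ≡⟨ ⊕-comm (A - a) S ⟩
        S ⊕ (A - a) ∎
        where open ≡-Reasoning

      module _ (H≤G : IsSubgroup H) (S⊆H : S ⊆ H) (0∈A : 0# ∈ A) where

        open Subgroup H≤G

        module Reflection {x : Fin n} (x∈H : x ∈ H) where

          reflection : Permutation′ n
          reflection = permutation (x //_) (x //_) (x//[x//y]≡y x) (x//[x//y]≡y x)

          ∣preimage∣≡ : ∀ p → ∣ preimage (x //_) p ∣ ≡ ∣ p ∣
          ∣preimage∣≡ = ∣preimage∣≡∣p∣ reflection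

          -- Since x //_ is an involution, this preimage is the reflected set x − (H ∖ (A + S)).
          Q : Subset n
          Q = preimage (x //_) (H ─ (A ⊕ S))

          Q⊆H : Q ⊆ H
          Q⊆H {g} g∈Q = subst (_∈ H) (x//[x//y]≡y x g) (//-closed x∈H (p─q⊆p H _ (∈-preimage⁻ g∈Q)))

          A∪Q⊆H : A ∪ Q ⊆ H
          A∪Q⊆H g∈ with x∈p∪q⁻ A Q g∈
          ... | inj₁ g∈A = A⊆H g∈A
          ... | inj₂ g∈Q = Q⊆H g∈Q

          Q⊕S⊆preimage[H─A] : Q ⊕ S ⊆ preimage (x //_) (H ─ A)
          Q⊕S⊆preimage[H─A] z∈ with ∈-⊕⁻ z∈
          ... | q , s , q∈Q , s∈S , refl =
            ∈-preimage⁺ (x∈p∧x∉q⇒x∈p─q (//-closed x∈H (∙-closed (Q⊆H q∈Q) (S⊆H s∈S))) x//[q∙s]∉A)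
            where
            x//[q∙s]∉A : x // (q ∙ s) ∉ A
            x//[q∙s]∉A x//[q∙s]∈A = x∈p─q⇒x∉q (∈-preimage⁻ q∈Q)
              (subst (_∈ A ⊕ S) ([x//[y∙z]]∙z≡x//y x q s) (∈-⊕⁺ x//[q∙s]∈A s∈S))

          ∣Q⊕S∣+∣A∣≤∣A⊕S∣+∣Q∣ : ∣ Q ⊕ S ∣ + ∣ A ∣ ≤ ∣ A ⊕ S ∣ + ∣ Q ∣
          ∣Q⊕S∣+∣A∣≤∣A⊕S∣+∣Q∣ = begin
            ∣ Q ⊕ S ∣ + ∣ A ∣                    ≤⟨ +-monoˡ-≤ ∣ A ∣ (p⊆q⇒∣p∣≤∣q∣ Q⊕S⊆preimage[H─A]) ⟩
            ∣ preimage (x //_) (H ─ A) ∣ + ∣ A ∣ ≡⟨ cong (_+ ∣ A ∣) (∣preimage∣≡ (H ─ A)) ⟩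
            ∣ H ─ A ∣ + ∣ A ∣                    ≡⟨ q⊆p⇒∣p─q∣+∣q∣≡∣p∣ A⊆H ⟩
            ∣ H ∣                                ≤⟨ ∣p∣≤∣p─q∣+∣q∣ H (A ⊕ S) ⟩
            ∣ H ─ (A ⊕ S) ∣ + ∣ A ⊕ S ∣          ≡⟨ cong (_+ ∣ A ⊕ S ∣) (∣preimage∣≡ (H ─ (A ⊕ S))) ⟨
            ∣ Q ∣ + ∣ A ⊕ S ∣                    ≡⟨ +-comm ∣ Q ∣ ∣ A ⊕ S ∣ ⟩
            ∣ A ⊕ S ∣ + ∣ Q ∣                    ∎
            where open ≤-Reasoning

          preimage[A∩Q]⊆H─[A∪Q]⊕S : preimage (x //_) (A ∩ Q) ⊆ H ─ ((A ∪ Q) ⊕ S)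
          preimage[A∩Q]⊆H─[A∪Q]⊕S {g} g∈ = x∈p∧x∉q⇒x∈p─q (p─q⊆p H _ g∈H─A⊕S) g∉[A∪Q]⊕S
            where
            x//g∈A : x // g ∈ A
            x//g∈A = p∩q⊆p A Q (∈-preimage⁻ g∈)
            g∈H─A⊕S : g ∈ H ─ (A ⊕ S)
            g∈H─A⊕S = subst (_∈ H ─ (A ⊕ S)) (x//[x//y]≡y x g) (∈-preimage⁻ (p∩q⊆q A Q (∈-preimage⁻ g∈)))
            g∉[A∪Q]⊕S : g ∉ (A ∪ Q) ⊕ S
            g∉[A∪Q]⊕S g∈′ with ∈-⊕⁻ g∈′
            ... | y , s , y∈A∪Q , s∈S , refl with x∈p∪q⁻ A Q y∈A∪Q
            ...   | inj₁ y∈A = x∈p─q⇒x∉q g∈H─A⊕S (∈-⊕⁺ y∈A s∈S)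
            ...   | inj₂ y∈Q = x∈p─q⇒x∉q (∈-preimage⁻ y∈Q)
                      (subst (_∈ A ⊕ S) ([x//[y∙z]]∙z≡x//y x y s) (∈-⊕⁺ x//g∈A s∈S))

          ∣[A∪Q]⊕S∣+∣A∩Q∣≤∣H∣ : ∣ (A ∪ Q) ⊕ S ∣ + ∣ A ∩ Q ∣ ≤ ∣ H ∣
          ∣[A∪Q]⊕S∣+∣A∩Q∣≤∣H∣ = begin
            ∣ (A ∪ Q) ⊕ S ∣ + ∣ A ∩ Q ∣                    ≡⟨ cong (∣ (A ∪ Q) ⊕ S ∣ +_) (∣preimage∣≡ (A ∩ Q)) ⟨
            ∣ (A ∪ Q) ⊕ S ∣ + ∣ preimage (x //_) (A ∩ Q) ∣ ≤⟨ +-monoʳ-≤ _ (p⊆q⇒∣p∣≤∣q∣ preimage[A∩Q]⊆H─[A∪Q]⊕S) ⟩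
            ∣ (A ∪ Q) ⊕ S ∣ + ∣ H ─ ((A ∪ Q) ⊕ S) ∣        ≡⟨ +-comm ∣ (A ∪ Q) ⊕ S ∣ _ ⟩
            ∣ H ─ ((A ∪ Q) ⊕ S) ∣ + ∣ (A ∪ Q) ⊕ S ∣        ≡⟨ q⊆p⇒∣p─q∣+∣q∣≡∣p∣ (⊕-closed A∪Q⊆H S⊆H) ⟩
            ∣ H ∣                                          ∎
            where open ≤-Reasoning

          module _ (2≤∣A∩Q∣ : 2 ≤ ∣ A ∩ Q ∣) where

            A∩Q-admissible : Admissible₂ S H (A ∩ Q)
            A∩Q-admissible = (λ g∈ → A⊆H (p∩q⊆p A Q g∈)) , 2≤∣A∩Q∣ ,
              ≤-trans (p⊆q⇒∣p∣≤∣q∣ (⊕-monoˡ S (p∩q⊆p A Q))) ∣A⊕S∣≤∣H∣∸2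

            A∪Q-admissible : Admissible₂ S H (A ∪ Q)
            A∪Q-admissible = A∪Q⊆H , ≤-trans 2≤∣A∣ (∣p∣≤∣p∪q∣ A Q) ,
              m+n≤o⇒m≤o∸n _ (≤-trans (+-monoʳ-≤ _ 2≤∣A∩Q∣) ∣[A∪Q]⊕S∣+∣A∩Q∣≤∣H∣)

            ∣[A∩Q]⊕S∣+∣A∣≤∣A⊕S∣+∣A∩Q∣ : ∣ (A ∩ Q) ⊕ S ∣ + ∣ A ∣ ≤ ∣ A ⊕ S ∣ + ∣ A ∩ Q ∣
            ∣[A∩Q]⊕S∣+∣A∣≤∣A⊕S∣+∣A∩Q∣ = excess-submodular
              {∣ A ∩ Q ∣} {∣ (A ∩ Q) ⊕ S ∣} {∣ A ∪ Q ∣} {∣ (A ∪ Q) ⊕ S ∣} {∣ A ∣} {∣ A ⊕ S ∣} {∣ Q ∣} {∣ Q ⊕ S ∣}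
              (⊕-submodular A Q S) (∣p∩q∣+∣p∪q∣≡∣p∣+∣q∣ A Q)
              ∣Q⊕S∣+∣A∣≤∣A⊕S∣+∣Q∣ (fragment-optimal (proj₁ atom) A∪Q-admissible)

        x∉A⊕S∧x//a∈A⊕S⇒x//b∈A⊕S : ∀ {x a b} → x ∈ H → x ∉ A ⊕ S → a ∈ A → x // a ∈ A ⊕ S →
                                   b ∈ A → b ≢ 0# → x // b ∈ A ⊕ S
        x∉A⊕S∧x//a∈A⊕S⇒x//b∈A⊕S {x} {a} {b} x∈H x∉A⊕S a∈A x//a∈A⊕S b∈A b≢0 with x // b ∈? A ⊕ S
        ... | yes x//b∈A⊕S = x//b∈A⊕S
        ... | no x//b∉A⊕S = contradiction
                (atom-minimal atom (A∩Q-admissible 2≤∣A∩Q∣) (∣[A∩Q]⊕S∣+∣A∣≤∣A⊕S∣+∣A∩Q∣ 2≤∣A∩Q∣)) (<⇒≱ ∣A∩Q∣<∣A∣)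
          where
          open Reflection x∈H
          0∈A∩Q : 0# ∈ A ∩ Q
          0∈A∩Q = x∈p∩q⁺ (0∈A , ∈-preimage⁺ (subst (_∈ H ─ (A ⊕ S)) (sym (x//0≡x x)) (x∈p∧x∉q⇒x∈p─q x∈H x∉A⊕S)))
          b∈A∩Q : b ∈ A ∩ Q
          b∈A∩Q = x∈p∩q⁺ (b∈A , ∈-preimage⁺ (x∈p∧x∉q⇒x∈p─q (//-closed x∈H (A⊆H b∈A)) x//b∉A⊕S))
          2≤∣A∩Q∣ : 2 ≤ ∣ A ∩ Q ∣
          2≤∣A∩Q∣ = x∈p∧y∈p∧x≢y⇒2≤∣p∣ b∈A∩Q 0∈A∩Q b≢0
          A∩Q⊆A-a : A ∩ Q ⊆ A - a
          A∩Q⊆A-a g∈ = x∈p∧x≢y⇒x∈p-y (p∩q⊆p A Q g∈)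
            λ { refl → x∈p─q⇒x∉q (∈-preimage⁻ (p∩q⊆q A Q g∈)) x//a∈A⊕S }
          ∣A∩Q∣<∣A∣ : ∣ A ∩ Q ∣ < ∣ A ∣
          ∣A∩Q∣<∣A∣ = ≤-<-trans (p⊆q⇒∣p∣≤∣q∣ A∩Q⊆A-a) (x∈p⇒∣p-x∣<∣p∣ a∈A)

        w//b∈[S⊕A]─S : ∀ {w b} → w ∈ (S ⊕ (A ⊕ A)) ─ (S ⊕ A) → b ∈ A - 0# → w // b ∈ (S ⊕ A) ─ S
        w//b∈[S⊕A]─S {b = b} w∈N₂ b∈A* with ∈-⊕⁻ (p─q⊆p _ _ w∈N₂)
        ... | s , u , s∈S , u∈A⊕A , refl with ∈-⊕⁻ u∈A⊕A
        ...   | a₁ , a₂ , a₁∈A , a₂∈A , refl = x∈p∧x∉q⇒x∈p─q (A⊕S⊆S⊕A w//b∈A⊕S) w//b∉S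
          where
          w : Fin n
          w = s ∙ (a₁ ∙ a₂)
          S⊕A⊆A⊕S : S ⊕ A ⊆ A ⊕ S
          S⊕A⊆A⊕S = subst (_ ∈_) (⊕-comm S A)
          A⊕S⊆S⊕A : A ⊕ S ⊆ S ⊕ A
          A⊕S⊆S⊕A = subst (_ ∈_) (⊕-comm A S)
          b∈A : b ∈ A
          b∈A = p─q⊆p A _ b∈A*
          w//a₂∈A⊕S : w // a₂ ∈ A ⊕ S
          w//a₂∈A⊕S = S⊕A⊆A⊕S (subst (_∈ S ⊕ A) (sym ([x∙[y∙z]]//z≡x∙y s a₁ a₂)) (∈-⊕⁺ s∈S a₁∈A))
          w//b∈A⊕S : w // b ∈ A ⊕ S
          w//b∈A⊕S = x∉A⊕S∧x//a∈A⊕S⇒x//b∈A⊕S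
            (∙-closed (S⊆H s∈S) (∙-closed (A⊆H a₁∈A) (A⊆H a₂∈A)))
            (λ w∈A⊕S → x∈p─q⇒x∉q w∈N₂ (A⊕S⊆S⊕A w∈A⊕S))
            a₂∈A w//a₂∈A⊕S b∈A (x∉⁅y⁆⇒x≢y (x∈p─q⇒x∉q b∈A*))
          w//b∉S : w // b ∉ S
          w//b∉S w//b∈S = x∈p─q⇒x∉q w∈N₂ (subst (_∈ S ⊕ A) ([x//y]∙y≡x w b) (∈-⊕⁺ w//b∈S b∈A))

        N₂⊖A*⊆N₁ : N 2 S A ⊖ (A - 0#) ⊆ N 1 S A
        N₂⊖A*⊆N₁ z∈ with ∈-image₂⁻ _ (N 2 S A) (A - 0#) z∈
        ... | w , b , w∈N₂ , b∈A* , refl =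
          subst (w // b ∈_) (sym (N₁≡ S A)) (w//b∈[S⊕A]─S (subst (w ∈_) (N₂≡ S A) w∈N₂) b∈A*)

lemma4p2 : (G : FinAbGroup) → let open Ops G in
    (S H A : Subset n) →
    0# ∈ S → IsGeneratedBy H S → TwoSeparable S H →
    TwoAtom S H A → 0# ∈ A → 3 ≤ ∣ A ∣ → ¬ IsSubgroup A →
    (∀ a → a ∈ A → S ⊕ A ≡ S ⊕ (A - a))
    × (N 2 S A ⊖ (A - 0#)) ⊆ N 1 S A
lemma4p2 G S H A 0∈S (H≤G , S⊆H , _) _ atom 0∈A 3≤∣A∣ _ =
  (λ a a∈A → S⊕A≡S⊕[A-a] 3≤∣A∣ a∈A) , N₂⊖A*⊆N₁ H≤G S⊆H 0∈A
  where open TwoAtoms.Atom G 0∈S atom
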